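{- Let $n\ge1$ and let $\psi:\mathcal{F}_n^\infty\to\mathcal{F}_n^\infty$ be defined by $\psi(P)=A^{ -1}\bigl([1,n-1]\setminus A(P)\bigr)$. Then for all $P,Q\in\mathcal{F}_n^\infty$, $Q$ covers $P$ in $\mathbb{F}_n^\infty$ if and only if $\psi(P)$ covers $\psi(Q)$ in $\mathbb{F}_n^\infty$. Consequently $\psi$ (complementation of the associated subsets) is an order-reversing involution of $\mathbb{F}_n^\infty$.
   Context: A Dyck path of semilength $n\ge 0$ is a lattice path from $(0,0)$ to $(2n,0)$ with steps $U=(1,1)$ and $D=(1,-1)$ that never goes below the $x$-axis; it is identified with its word over $\{U,D\}$. A path avoids a pattern $\alpha$ if $\alpha$ does not occur as a factor (block of consecutive steps). $\mathcal{F}_n^\infty$ is the set of Dyck paths of semilength $n$ avoiding $DUU$, ordered by the Stanley order: $P\le Q$ iff $P$ lies weakly below $Q$ when both are drawn in the plane; $\mathbb{F}_n^\infty=(\mathcal{F}_n^\infty,\le)$; $Q$ covers $P$ if $P<Q$ with nothing strictly between. For $P\in\mathcal{F}_n^\infty$, write $P=U^iDR$ where $i$ is the length of the initial run of $U$ steps; then $R$ contains $n-1$ steps $D$, which are labeled $1,\dots,n-1$ from left to right. $A(P)\subseteq[1,n-1]$ is the set of labels of those $D$ steps of $R$ that are not immediately preceded by a $U$ step in $R$. The map $A$ is a bijection from $\mathcal{F}_n^\infty$ onto the set of all subsets of $[1,n-1]=\{1,\dots,n-1\}$. -}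

module Defs where

open import Data.Bool using (Bool; true; false; not)
open import Data.Nat using (ℕ; zero; suc; _*_)
open import Data.Integer using (ℤ; _+_; _-_; _≤_; +_)
open import Data.List using (List; []; _∷_; _++_; take; length; map)
open import Data.Product using (Σ; ∃; ∃-syntax; _×_; proj₁)
open import Relation.Binary.PropositionalEquality using (_≡_; _≢_)
open import Relation.Nullary using (¬_)

data Step : Set where
  U D : Step

height : List Step → ℤ
height []      = + 0
height (U ∷ w) = + 1 + height w
height (D ∷ w) = height w - + 1

heightAt : List Step → ℕ → ℤ
heightAt w k = height (take k w)

IsDyck : ℕ → List Step → Set
IsDyck n w = (length w ≡ 2 * n) × (∀ k → + 0 ≤ heightAt w k) × (height w ≡ + 0)

Avoids : List Step → List Step → Set
Avoids α w = ¬ (∃[ xs ] ∃[ ys ] (w ≡ xs ++ α ++ ys))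

F∞ : ℕ → Set
F∞ n = Σ (List Step) (λ w → IsDyck n w × Avoids (D ∷ U ∷ U ∷ []) w)

_≤S_ : ∀ {n} → F∞ n → F∞ n → Set
P ≤S Q = ∀ k → heightAt (proj₁ P) k ≤ heightAt (proj₁ Q) k

_<S_ : ∀ {n} → F∞ n → F∞ n → Set
_<S_ {n} P Q = (_≤S_ {n} P Q) × (proj₁ P ≢ proj₁ Q)

Covers : ∀ {n} → F∞ n → F∞ n → Set
Covers {n} Q P = (_<S_ {n} P Q) × ¬ (Σ (F∞ n) (λ R → (_<S_ {n} P R) × (_<S_ {n} R Q)))

-- Write P = U^i D R: dropInit returns R.
dropInit : List Step → List Step
dropInit []      = []
dropInit (U ∷ w) = dropInit w
dropInit (D ∷ w) = w

-- Scan R; the Boolean flag records whether the previous step of R was U.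
-- One Boolean is emitted per D step of R (the j-th entry corresponds to label j),
-- true iff that D step is NOT immediately preceded by a U step in R.
scanA : Bool → List Step → List Bool
scanA p []      = []
scanA p (U ∷ r) = scanA true r
scanA p (D ∷ r) = not p ∷ scanA false r

-- A(P) ⊆ [1, n-1] as its characteristic list (entry j-1 is true iff j ∈ A(P)).
A : ∀ {n} → F∞ n → List Bool
A {n} P = scanA false (dropInit (proj₁ P))

complement : List Bool → List Bool
complement = map not

{-# OPTIONS --safe #-}
module Submission where

open import Defs
open import Data.Nat using (ℕ; zero; suc; _+_; _*_; _∸_; _⊓_; _≤_; _<_; z≤n; s≤s; z<s; s<s; _≤?_)
open import Data.Nat.Properties
open import Data.Integer as ℤ using (ℤ; 0ℤ; 1ℤ; _⊖_)
import Data.Integer.Properties as ℤₚ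
open import Data.Bool using (Bool; true; false; not)
open import Data.Bool.Properties using (not-involutive)
open import Function.Base using (_∘_)
open import Data.List using (List; []; _∷_; _++_; take; drop; length; map; replicate)
open import Data.List.Properties
  using (++-assoc; length-take; length-drop; length-map; drop-map; drop-all; map-∘; map-cong; map-id)
open import Data.Product using (Σ; _×_; _,_; proj₁; ∃-syntax)
open import Data.Sum using (_⊎_; inj₁; inj₂)
import Data.Sum as Sum
open import Data.Empty using (⊥; ⊥-elim)
open import Data.Unit using (⊤)
open import Relation.Nullary using (¬_; yes; no; contradiction)
open import Relation.Binary.PropositionalEquality
  using (_≡_; _≢_; refl; sym; trans; cong; cong₂; subst; subst₂; module ≡-Reasoning)
open import Function.Bundles using (_⇔_; mk⇔; Equivalence)
open import Function.Properties.Equivalence using () renaming (trans to ⇔-trans)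

-- A DUU-avoiding Dyck path with n ≥ 1 is U^i D R where R is a word in the blocks D and UD,
-- the block ending in the j-th down step of R being D exactly when j ∈ A(P); the final
-- height 0 then forces i = 1 + |A(P)|, so A is a bijection with inverse enc.
-- Comparing heights of two paths of equal length is comparing the positions of their down
-- steps, and in enc(S) the down step numbered j (from 0) sits at 1 + 2j + |S ∩ [j+1, n-1]|.
-- Hence P ≤ Q iff |A(P) ∩ [j+1, n-1]| ≤ |A(Q) ∩ [j+1, n-1]| for all j. Complementation
-- replaces each of these counts c by (n-1-j) - c, so it reverses this order, and an
-- order-reversing involution exchanges the covering relations.

ups : List Step → ℕ
ups []      = 0
ups (U ∷ w) = suc (ups w)
ups (D ∷ w) = ups w

downs : List Step → ℕ
downs []      = 0
downs (U ∷ w) = downs w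
downs (D ∷ w) = suc (downs w)

length≡downs+ups : ∀ w → length w ≡ downs w + ups w
length≡downs+ups []      = refl
length≡downs+ups (U ∷ w) = trans (cong suc (length≡downs+ups w)) (sym (+-suc (downs w) (ups w)))
length≡downs+ups (D ∷ w) = cong suc (length≡downs+ups w)

height≡ups⊖downs : ∀ w → height w ≡ ups w ⊖ downs w
height≡ups⊖downs []      = refl
height≡ups⊖downs (U ∷ w) = trans (cong (λ h → 1ℤ ℤ.+ h) (height≡ups⊖downs w))
                                 (ℤₚ.distribʳ-⊖-+-pos 1 (ups w) (downs w))
height≡ups⊖downs (D ∷ w) = begin
  height w ℤ.- 1ℤ           ≡⟨ cong (ℤ._- 1ℤ) (height≡ups⊖downs w) ⟩
  (ups w ⊖ downs w) ℤ.- 1ℤ  ≡⟨ ℤₚ.distribˡ-⊖-+-neg 0 (ups w) (downs w) ⟩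
  ups w ⊖ suc (downs w + 0) ≡⟨ cong (λ d → ups w ⊖ suc d) (+-identityʳ (downs w)) ⟩
  ups w ⊖ suc (downs w)     ∎
  where open ≡-Reasoning

height≡length⊖2*downs : ∀ w → height w ≡ length w ⊖ 2 * downs w
height≡length⊖2*downs w = begin
  height w                                ≡⟨ height≡ups⊖downs w ⟩
  ups w ⊖ downs w                         ≡⟨ ℤₚ.+-cancelˡ-⊖ (downs w) (ups w) (downs w) ⟨
  (downs w + ups w) ⊖ (downs w + downs w) ≡⟨ cong₂ _⊖_ (sym (length≡downs+ups w))
                                               (cong (downs w +_) (sym (+-identityʳ (downs w)))) ⟩
  length w ⊖ 2 * downs w                  ∎
  where open ≡-Reasoning

⊖-cancelˡ-≤ : ∀ m {a b} → m ⊖ a ℤ.≤ m ⊖ b → b ≤ a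
⊖-cancelˡ-≤ m m⊖a≤m⊖b = ≮⇒≥ (λ a<b → ℤₚ.<⇒≱ (ℤₚ.⊖-monoʳ->-< m a<b) m⊖a≤m⊖b)

0≤m⊖n⇔n≤m : ∀ {m n} → 0ℤ ℤ.≤ m ⊖ n ⇔ n ≤ m
0≤m⊖n⇔n≤m {m} {n} = mk⇔
  (λ 0≤m⊖n → ⊖-cancelˡ-≤ m (subst (ℤ._≤ m ⊖ n) (sym (ℤₚ.n⊖n≡0 m)) 0≤m⊖n))
  (λ n≤m → subst (ℤ._≤ m ⊖ n) (ℤₚ.n⊖n≡0 m) (ℤₚ.⊖-monoʳ-≥-≤ m n≤m))

m⊖n≡0⇒m≡n : ∀ {m n} → m ⊖ n ≡ 0ℤ → m ≡ n
m⊖n≡0⇒m≡n {m} {n} eq = ≤-antisym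
  (⊖-cancelˡ-≤ m (ℤₚ.≤-reflexive (trans eq (sym (ℤₚ.n⊖n≡0 m)))))
  (⊖-cancelˡ-≤ m (ℤₚ.≤-reflexive (trans (ℤₚ.n⊖n≡0 m) (sym eq))))

height≡0⇒ups≡downs : ∀ w → height w ≡ 0ℤ → ups w ≡ downs w
height≡0⇒ups≡downs w flat = m⊖n≡0⇒m≡n (trans (sym (height≡ups⊖downs w)) flat)

Nonnegative : List Step → Set
Nonnegative w = ∀ k → 0ℤ ℤ.≤ heightAt w k

Above : ℕ → List Step → Set
Above h       []      = ⊤
Above h       (U ∷ w) = Above (suc h) w
Above zero    (D ∷ w) = ⊥
Above (suc h) (D ∷ w) = Above h w

Above⇒downs≤h+ups : ∀ h w k → Above h w → downs (take k w) ≤ h + ups (take k w)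
Above⇒downs≤h+ups h       w       zero    _     = z≤n
Above⇒downs≤h+ups h       []      (suc k) _     = z≤n
Above⇒downs≤h+ups h       (U ∷ w) (suc k) above =
  subst (downs (take k w) ≤_) (sym (+-suc h _)) (Above⇒downs≤h+ups (suc h) w k above)
Above⇒downs≤h+ups (suc h) (D ∷ w) (suc k) above = s≤s (Above⇒downs≤h+ups h w k above)

Above⇒nonnegative : ∀ {w} → Above 0 w → Nonnegative w
Above⇒nonnegative {w} above k = subst (0ℤ ℤ.≤_) (sym (height≡ups⊖downs (take k w)))
  (Equivalence.from 0≤m⊖n⇔n≤m (Above⇒downs≤h+ups 0 w k above))

DUU : List Step
DUU = D ∷ U ∷ U ∷ []

Avoids-[] : ∀ {a α} → Avoids (a ∷ α) []
Avoids-[] ([]    , _ , ())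
Avoids-[] (_ ∷ _ , _ , ())

Avoids-∷ : ∀ {α x w} → (∀ ys → x ∷ w ≢ α ++ ys) → Avoids α w → Avoids α (x ∷ w)
Avoids-∷ not-prefix _      ([]     , ys , eq)   = not-prefix ys eq
Avoids-∷ _          avoids (_ ∷ xs , ys , refl) = avoids (xs , ys , refl)

Avoids-++ʳ : ∀ {α} v {w} → Avoids α (v ++ w) → Avoids α w
Avoids-++ʳ {α} v avoids (xs , ys , refl) = avoids (v ++ xs , ys , sym (++-assoc v xs (α ++ ys)))

-- The inverse of A

U^_D∷_ : ℕ → List Step → List Step
U^ i D∷ R = replicate i U ++ D ∷ R

dropInit-U^D∷ : ∀ i R → dropInit (U^ i D∷ R) ≡ R
dropInit-U^D∷ zero    R = refl
dropInit-U^D∷ (suc i) R = dropInit-U^D∷ i R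

ups-U^D∷ : ∀ i R → ups (U^ i D∷ R) ≡ i + ups R
ups-U^D∷ zero    R = refl
ups-U^D∷ (suc i) R = cong suc (ups-U^D∷ i R)

downs-U^D∷ : ∀ i R → downs (U^ i D∷ R) ≡ suc (downs R)
downs-U^D∷ zero    R = refl
downs-U^D∷ (suc i) R = downs-U^D∷ i R

Above-U^D∷ : ∀ h i R → Above (i + h) (D ∷ R) → Above h (U^ i D∷ R)
Above-U^D∷ h zero    R above = above
Above-U^D∷ h (suc i) R above =
  Above-U^D∷ (suc h) i R (subst (λ g → Above g (D ∷ R)) (sym (+-suc i h)) above)

Avoids-U^D∷ : ∀ i R → Avoids DUU (D ∷ R) → Avoids DUU (U^ i D∷ R)
Avoids-U^D∷ zero    R avoids = avoids
Avoids-U^D∷ (suc i) R avoids = Avoids-∷ (λ _ ()) (Avoids-U^D∷ i R avoids)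

split-at-first-D : ∀ w → downs w ≡ 0 ⊎ ∃[ i ] ∃[ R ] w ≡ U^ i D∷ R
split-at-first-D []      = inj₁ refl
split-at-first-D (D ∷ w) = inj₂ (0 , w , refl)
split-at-first-D (U ∷ w) with split-at-first-D w
... | inj₁ no-D            = inj₁ no-D
... | inj₂ (i , R , w≡U^D∷) = inj₂ (suc i , R , cong (U ∷_) w≡U^D∷)

-- enc S = A⁻¹(S): label j ∈ S gives the block D, label j ∉ S the block UD.
body : List Bool → List Step
body []          = []
body (true ∷ s)  = D ∷ body s
body (false ∷ s) = U ∷ D ∷ body s

trues : List Bool → ℕ
trues []          = 0
trues (true ∷ s)  = suc (trues s)
trues (false ∷ s) = trues s

enc : List Bool → List Step
enc s = U^ suc (trues s) D∷ body s

scanA-body : ∀ s → scanA false (body s) ≡ s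
scanA-body []          = refl
scanA-body (true ∷ s)  = cong (true ∷_) (scanA-body s)
scanA-body (false ∷ s) = cong (false ∷_) (scanA-body s)

A-enc : ∀ s → scanA false (dropInit (enc s)) ≡ s
A-enc s = trans (cong (scanA false) (dropInit-U^D∷ (suc (trues s)) (body s))) (scanA-body s)

downs-body : ∀ s → downs (body s) ≡ length s
downs-body []          = refl
downs-body (true ∷ s)  = cong suc (downs-body s)
downs-body (false ∷ s) = cong suc (downs-body s)

trues+ups-body : ∀ s → trues s + ups (body s) ≡ length s
trues+ups-body []          = refl
trues+ups-body (true ∷ s)  = cong suc (trues+ups-body s)
trues+ups-body (false ∷ s) = trans (+-suc (trues s) _) (cong suc (trues+ups-body s))

Above-body : ∀ e s → Above (trues s + e) (body s)
Above-body e []          = _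
Above-body e (true ∷ s)  = Above-body e s
Above-body e (false ∷ s) = Above-body e s

Avoids-D∷body : ∀ s → Avoids DUU (D ∷ body s)
Avoids-D∷body []          = Avoids-∷ (λ _ ()) Avoids-[]
Avoids-D∷body (true ∷ s)  = Avoids-∷ (λ _ ()) (Avoids-D∷body s)
Avoids-D∷body (false ∷ s) = Avoids-∷ (λ _ ()) (Avoids-∷ (λ _ ()) (Avoids-D∷body s))

ups-enc : ∀ s → ups (enc s) ≡ suc (length s)
ups-enc s = trans (ups-U^D∷ (suc (trues s)) (body s)) (cong suc (trues+ups-body s))

downs-enc : ∀ s → downs (enc s) ≡ suc (length s)
downs-enc s = trans (downs-U^D∷ (suc (trues s)) (body s)) (cong suc (downs-body s))

length-enc : ∀ s → length (enc s) ≡ 2 * suc (length s)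
length-enc s = trans (length≡downs+ups (enc s))
  (cong₂ _+_ (downs-enc s) (trans (ups-enc s) (sym (+-identityʳ _))))

enc-isDyck : ∀ s → IsDyck (suc (length s)) (enc s)
enc-isDyck s =
  length-enc s ,
  Above⇒nonnegative (Above-U^D∷ 0 (suc (trues s)) (body s) (Above-body 0 s)) ,
  trans (height≡ups⊖downs (enc s))
        (trans (cong₂ _⊖_ (ups-enc s) (downs-enc s)) (ℤₚ.n⊖n≡0 (suc (length s))))

encode : ∀ {n} s → suc (length s) ≡ n → F∞ n
encode s eq =
  enc s , subst (λ m → IsDyck m (enc s)) eq (enc-isDyck s) ,
  Avoids-U^D∷ (suc (trues s)) (body s) (Avoids-D∷body s)

-- Surjectivity of enc

take-length-++ : ∀ {a} {A : Set a} (v w : List A) → take (length v) (v ++ w) ≡ v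
take-length-++ []      w = refl
take-length-++ (x ∷ v) w = cong (x ∷_) (take-length-++ v w)

ups-++-U : ∀ v → ups (v ++ U ∷ []) ≡ suc (ups v)
ups-++-U []      = refl
ups-++-U (U ∷ v) = cong suc (ups-++-U v)
ups-++-U (D ∷ v) = ups-++-U v

downs-++-U : ∀ v → downs (v ++ U ∷ []) ≡ downs v
downs-++-U []      = refl
downs-++-U (U ∷ v) = downs-++-U v
downs-++-U (D ∷ v) = cong suc (downs-++-U v)

Dyck-last-step≢U : ∀ v → Nonnegative (v ++ U ∷ []) → height (v ++ U ∷ []) ≢ 0ℤ
Dyck-last-step≢U v nonneg flat = <-irrefl refl (≤-trans (≤-reflexive balance) below)
  where
  below : downs v ≤ ups v
  below = Equivalence.to 0≤m⊖n⇔n≤m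
    (subst (0ℤ ℤ.≤_) (trans (cong height (take-length-++ v _)) (height≡ups⊖downs v))
      (nonneg (length v)))
  balance : suc (ups v) ≡ downs v
  balance = trans (sym (ups-++-U v)) (trans (height≡0⇒ups≡downs (v ++ U ∷ []) flat) (downs-++-U v))

body-decomposition : ∀ R → Avoids DUU (D ∷ R) →
  R ≡ body (scanA false R) ⊎ R ≡ body (scanA false R) ++ U ∷ []
body-decomposition []          _      = inj₁ refl
body-decomposition (U ∷ [])    _      = inj₂ refl
body-decomposition (U ∷ U ∷ R) avoids = ⊥-elim (avoids ([] , R , refl))
body-decomposition (U ∷ D ∷ R) avoids =
  Sum.map (cong (λ R′ → U ∷ D ∷ R′)) (cong (λ R′ → U ∷ D ∷ R′))
    (body-decomposition R (Avoids-++ʳ (D ∷ U ∷ []) avoids))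
body-decomposition (D ∷ R)     avoids =
  Sum.map (cong (D ∷_)) (cong (D ∷_)) (body-decomposition R (Avoids-++ʳ (D ∷ []) avoids))

height≡0⇒U^D∷body≡enc : ∀ i s → height (U^ i D∷ body s) ≡ 0ℤ → U^ i D∷ body s ≡ enc s
height≡0⇒U^D∷body≡enc i s flat =
  cong (U^_D∷ body s) (+-cancelʳ-≡ (ups (body s)) i (suc (trues s)) (begin
  i + ups (body s)             ≡⟨ ups-U^D∷ i (body s) ⟨
  ups (U^ i D∷ body s)         ≡⟨ height≡0⇒ups≡downs (U^ i D∷ body s) flat ⟩
  downs (U^ i D∷ body s)       ≡⟨ downs-U^D∷ i (body s) ⟩
  suc (downs (body s))         ≡⟨ cong suc (trans (downs-body s) (sym (trues+ups-body s))) ⟩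
  suc (trues s + ups (body s)) ∎))
  where open ≡-Reasoning

U^D∷-decode : ∀ i R → Nonnegative (U^ i D∷ R) → height (U^ i D∷ R) ≡ 0ℤ →
  Avoids DUU (D ∷ R) → U^ i D∷ R ≡ enc (scanA false R)
U^D∷-decode i R nonneg flat avoids with body-decomposition R avoids
... | inj₁ R≡body =
  trans R-as-body (height≡0⇒U^D∷body≡enc i _ (subst (λ w → height w ≡ 0ℤ) R-as-body flat))
  where
  R-as-body : U^ i D∷ R ≡ U^ i D∷ body (scanA false R)
  R-as-body = cong (U^ i D∷_) R≡body
... | inj₂ R≡body++U = ⊥-elim (Dyck-last-step≢U (U^ i D∷ body (scanA false R))
  (subst Nonnegative R-as-body++U nonneg) (subst (λ w → height w ≡ 0ℤ) R-as-body++U flat))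
  where
  R-as-body++U : U^ i D∷ R ≡ U^ i D∷ body (scanA false R) ++ U ∷ []
  R-as-body++U = trans (cong (U^ i D∷_) R≡body++U)
    (sym (++-assoc (replicate i U) (D ∷ body (scanA false R)) (U ∷ [])))

decode : ∀ {n w} → 1 ≤ n → IsDyck n w → Avoids DUU w → w ≡ enc (scanA false (dropInit w))
decode {w = w} (s≤s _) (len , nonneg , flat) avoids with split-at-first-D w
... | inj₁ no-D = contradiction (trans (sym len) length≡0) λ ()
  where
  length≡0 : length w ≡ 0
  length≡0 = trans (length≡downs+ups w) (cong₂ _+_ no-D (trans (height≡0⇒ups≡downs w flat) no-D))
... | inj₂ (i , R , refl) = trans (U^D∷-decode i R nonneg flat (Avoids-++ʳ (replicate i U) avoids))
  (cong (λ R′ → enc (scanA false R′)) (sym (dropInit-U^D∷ i R)))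

-- The Stanley order through positions of down steps

-- indexOfD w j: the index in w (from 0) of the down step numbered j (from 0);
-- a junk value when w has at most j down steps.
indexOfD : List Step → ℕ → ℕ
indexOfD []      j       = 0
indexOfD (U ∷ w) j       = suc (indexOfD w j)
indexOfD (D ∷ w) zero    = 0
indexOfD (D ∷ w) (suc j) = suc (indexOfD w j)

j<downs-take⇒indexOfD< : ∀ w {j} k → j < downs (take k w) → indexOfD w j < k
j<downs-take⇒indexOfD< (U ∷ w)         (suc k) j<        = s<s (j<downs-take⇒indexOfD< w k j<)
j<downs-take⇒indexOfD< (D ∷ w) {zero}  (suc k) _         = z<s
j<downs-take⇒indexOfD< (D ∷ w) {suc j} (suc k) (s<s j<) = s<s (j<downs-take⇒indexOfD< w k j<)

indexOfD<⇒j<downs-take : ∀ w {j} k → j < downs w → indexOfD w j < k → j < downs (take k w)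
indexOfD<⇒j<downs-take (U ∷ w)         (suc k) j<       (s<s i<) = indexOfD<⇒j<downs-take w k j< i<
indexOfD<⇒j<downs-take (D ∷ w) {zero}  (suc k) _        _        = z<s
indexOfD<⇒j<downs-take (D ∷ w) {suc j} (suc k) (s<s j<) (s<s i<) = s<s (indexOfD<⇒j<downs-take w k j< i<)

downs-take≤downs : ∀ w k → downs (take k w) ≤ downs w
downs-take≤downs w       zero    = z≤n
downs-take≤downs []      (suc k) = z≤n
downs-take≤downs (U ∷ w) (suc k) = downs-take≤downs w k
downs-take≤downs (D ∷ w) (suc k) = s≤s (downs-take≤downs w k)

downs-take-≥⇔indexOfD-≤ : ∀ {w₁ w₂} → downs w₁ ≡ downs w₂ →
  (∀ k → downs (take k w₂) ≤ downs (take k w₁)) ⇔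
  (∀ j → j < downs w₁ → indexOfD w₁ j ≤ indexOfD w₂ j)
downs-take-≥⇔indexOfD-≤ {w₁} {w₂} same-downs = mk⇔ earlier-Ds fewer-Ds
  where
  earlier-Ds : (∀ k → downs (take k w₂) ≤ downs (take k w₁)) →
               ∀ j → j < downs w₁ → indexOfD w₁ j ≤ indexOfD w₂ j
  earlier-Ds fewer j j<downs = ≤-pred (j<downs-take⇒indexOfD< w₁ (suc (indexOfD w₂ j))
    (<-≤-trans (indexOfD<⇒j<downs-take w₂ _ (subst (j <_) same-downs j<downs) (n<1+n _))
               (fewer (suc (indexOfD w₂ j)))))

  fewer-Ds : (∀ j → j < downs w₁ → indexOfD w₁ j ≤ indexOfD w₂ j) →
             ∀ k → downs (take k w₂) ≤ downs (take k w₁)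
  fewer-Ds earlier k = ≮⇒≥ more-Ds-impossible
    where
    j : ℕ
    j = downs (take k w₁)
    more-Ds-impossible : ¬ j < downs (take k w₂)
    more-Ds-impossible j<downs₂ = <-irrefl refl (indexOfD<⇒j<downs-take w₁ k j<downs₁
        (≤-<-trans (earlier j j<downs₁) (j<downs-take⇒indexOfD< w₂ k j<downs₂)))
      where
      j<downs₁ : j < downs w₁
      j<downs₁ = subst (j <_) (sym same-downs) (<-≤-trans j<downs₂ (downs-take≤downs w₂ k))

heightAt-≤⇔downs-take-≥ : ∀ {w₁ w₂} → length w₁ ≡ length w₂ →
  (∀ k → heightAt w₁ k ℤ.≤ heightAt w₂ k) ⇔ (∀ k → downs (take k w₂) ≤ downs (take k w₁))
heightAt-≤⇔downs-take-≥ {w₁} {w₂} same-length =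
  mk⇔ (λ below k → Equivalence.to (at k) (below k)) (λ fewer k → Equivalence.from (at k) (fewer k))
  where
  at : ∀ k → (heightAt w₁ k ℤ.≤ heightAt w₂ k) ⇔ (downs (take k w₂) ≤ downs (take k w₁))
  at k = subst₂ (λ h₁ h₂ → (h₁ ℤ.≤ h₂) ⇔ (d₂ ≤ d₁))
           (sym (height≡length⊖2*downs (take k w₁))) (sym height₂)
           (mk⇔ (λ le → *-cancelˡ-≤ 2 (⊖-cancelˡ-≤ L le))
                (λ d₂≤d₁ → ℤₚ.⊖-monoʳ-≥-≤ L (*-monoʳ-≤ 2 d₂≤d₁)))
    where
    d₁ d₂ L : ℕ
    d₁ = downs (take k w₁)
    d₂ = downs (take k w₂)
    L  = length (take k w₁)
    height₂ : heightAt w₂ k ≡ L ⊖ 2 * d₂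
    height₂ = trans (height≡length⊖2*downs (take k w₂)) (cong (_⊖ 2 * d₂) (begin
      length (take k w₂)  ≡⟨ length-take k w₂ ⟩
      k ⊓ length w₂       ≡⟨ cong (k ⊓_) same-length ⟨
      k ⊓ length w₁       ≡⟨ length-take k w₁ ⟨
      L                   ∎))
      where open ≡-Reasoning

indexOfD-U^D∷ : ∀ i R j → indexOfD (U^ i D∷ R) j ≡ i + indexOfD (D ∷ R) j
indexOfD-U^D∷ zero    R j = refl
indexOfD-U^D∷ (suc i) R j = cong suc (indexOfD-U^D∷ i R j)

trues+indexOfD-D∷body : ∀ s j → j ≤ length s →
  trues s + indexOfD (D ∷ body s) j ≡ j + j + trues (drop j s)
trues+indexOfD-D∷body s           zero    _        = +-identityʳ (trues s)
trues+indexOfD-D∷body (true ∷ s)  (suc j) (s≤s j≤) = begin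
  suc (trues s + suc (indexOfD (D ∷ body s) j)) ≡⟨ cong suc (+-suc (trues s) _) ⟩
  suc (suc (trues s + indexOfD (D ∷ body s) j)) ≡⟨ cong (suc ∘ suc) (trues+indexOfD-D∷body s j j≤) ⟩
  suc (suc (j + j + trues (drop j s)))          ≡⟨ cong (λ m → suc (m + trues (drop j s))) (+-suc j j) ⟨
  suc j + suc j + trues (drop j s)              ∎
  where open ≡-Reasoning
trues+indexOfD-D∷body (false ∷ s) (suc j) (s≤s j≤) = begin
  trues s + suc (suc (indexOfD (D ∷ body s) j)) ≡⟨ +-suc (trues s) _ ⟩
  suc (trues s + suc (indexOfD (D ∷ body s) j)) ≡⟨ cong suc (+-suc (trues s) _) ⟩
  suc (suc (trues s + indexOfD (D ∷ body s) j)) ≡⟨ cong (suc ∘ suc) (trues+indexOfD-D∷body s j j≤) ⟩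
  suc (suc (j + j + trues (drop j s)))          ≡⟨ cong (λ m → suc (m + trues (drop j s))) (+-suc j j) ⟨
  suc j + suc j + trues (drop j s)              ∎
  where open ≡-Reasoning

indexOfD-enc : ∀ s j → j ≤ length s → indexOfD (enc s) j ≡ suc (j + j) + trues (drop j s)
indexOfD-enc s j j≤ =
  trans (indexOfD-U^D∷ (suc (trues s)) (body s) j) (cong suc (trues+indexOfD-D∷body s j j≤))

-- The Stanley order transported by A (drop j s lists the labels > j).
_⊑_ : List Bool → List Bool → Set
s ⊑ t = ∀ j → trues (drop j s) ≤ trues (drop j t)

indexOfD-enc-≤⇔⊑ : ∀ {s t} → length s ≡ length t →
  (∀ j → j < downs (enc s) → indexOfD (enc s) j ≤ indexOfD (enc t) j) ⇔ s ⊑ t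
indexOfD-enc-≤⇔⊑ {s} {t} same-length = mk⇔ to from
  where
  index-s : ∀ {j} → j ≤ length s → indexOfD (enc s) j ≡ suc (j + j) + trues (drop j s)
  index-s {j} j≤ = indexOfD-enc s j j≤
  index-t : ∀ {j} → j ≤ length s → indexOfD (enc t) j ≡ suc (j + j) + trues (drop j t)
  index-t {j} j≤ = indexOfD-enc t j (subst (j ≤_) same-length j≤)

  to : (∀ j → j < downs (enc s) → indexOfD (enc s) j ≤ indexOfD (enc t) j) → s ⊑ t
  to earlier j with j ≤? length s
  ... | yes j≤ = +-cancelˡ-≤ (suc (j + j)) _ _ (subst₂ _≤_ (index-s j≤) (index-t j≤)
                   (earlier j (subst (j <_) (sym (downs-enc s)) (s≤s j≤))))
  ... | no  j≰ = subst (_≤ trues (drop j t)) (cong trues (sym (drop-all j s (<⇒≤ (≰⇒> j≰))))) z≤n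

  from : s ⊑ t → ∀ j → j < downs (enc s) → indexOfD (enc s) j ≤ indexOfD (enc t) j
  from s⊑t j j<downs =
    subst₂ _≤_ (sym (index-s j≤)) (sym (index-t j≤)) (+-monoʳ-≤ (suc (j + j)) (s⊑t j))
    where
    j≤ : j ≤ length s
    j≤ = ≤-pred (subst (j <_) (downs-enc s) j<downs)

enc-≤⇔⊑ : ∀ {s t} → length s ≡ length t →
  (∀ k → heightAt (enc s) k ℤ.≤ heightAt (enc t) k) ⇔ s ⊑ t
enc-≤⇔⊑ {s} {t} same-length =
  ⇔-trans (heightAt-≤⇔downs-take-≥ same-enc-length)
  (⇔-trans (downs-take-≥⇔indexOfD-≤ same-enc-downs) (indexOfD-enc-≤⇔⊑ same-length))
  where
  same-enc-length : length (enc s) ≡ length (enc t)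
  same-enc-length =
    trans (length-enc s) (trans (cong (λ m → 2 * suc m) same-length) (sym (length-enc t)))
  same-enc-downs : downs (enc s) ≡ downs (enc t)
  same-enc-downs = trans (downs-enc s) (trans (cong suc same-length) (sym (downs-enc t)))

trues-not+trues : ∀ s → trues (map not s) + trues s ≡ length s
trues-not+trues []          = refl
trues-not+trues (true ∷ s)  = trans (+-suc (trues (map not s)) (trues s)) (cong suc (trues-not+trues s))
trues-not+trues (false ∷ s) = cong suc (trues-not+trues s)

complement-antitone : ∀ {s t} → length s ≡ length t → s ⊑ t → complement t ⊑ complement s
complement-antitone {s} {t} same-length s⊑t j = +-cancelʳ-≤ (trues (drop j s)) _ _ (begin
  trues (drop j (map not t)) + trues (drop j s) ≤⟨ +-monoʳ-≤ (trues (drop j (map not t))) (s⊑t j) ⟩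
  trues (drop j (map not t)) + trues (drop j t) ≡⟨ trues-not+trues-drop t ⟩
  length t ∸ j                                  ≡⟨ cong (_∸ j) same-length ⟨
  length s ∸ j                                  ≡⟨ trues-not+trues-drop s ⟨
  trues (drop j (map not s)) + trues (drop j s) ∎)
  where
  open ≤-Reasoning
  trues-not+trues-drop : ∀ u → trues (drop j (map not u)) + trues (drop j u) ≡ length u ∸ j
  trues-not+trues-drop u = trans (cong (λ v → trues v + trues (drop j u)) (drop-map j u))
    (trans (trues-not+trues (drop j u)) (length-drop j u))

complement-involutive : ∀ s → complement (complement s) ≡ s
complement-involutive s = trans (sym (map-∘ s)) (trans (map-cong not-involutive s) (map-id s))

≤S-resp : ∀ {n} {P P′ Q Q′ : F∞ n} → proj₁ P ≡ proj₁ P′ → proj₁ Q ≡ proj₁ Q′ →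
  _≤S_ {n} P Q → _≤S_ {n} P′ Q′
≤S-resp P≡P′ Q≡Q′ = subst₂ (λ v w → ∀ k → heightAt v k ℤ.≤ heightAt w k) P≡P′ Q≡Q′

<S-resp : ∀ {n} {P P′ Q Q′ : F∞ n} → proj₁ P ≡ proj₁ P′ → proj₁ Q ≡ proj₁ Q′ →
  _<S_ {n} P Q → _<S_ {n} P′ Q′
<S-resp {n} {P} {P′} {Q} {Q′} P≡P′ Q≡Q′ (P≤Q , P≢Q) =
  ≤S-resp {n} {P} {P′} {Q} {Q′} P≡P′ Q≡Q′ P≤Q , λ P′≡Q′ → P≢Q (trans P≡P′ (trans P′≡Q′ (sym Q≡Q′)))

module AntitoneInvolution {n} (ψ : F∞ n → F∞ n)
  (ψ-cong : ∀ {P Q} → proj₁ P ≡ proj₁ Q → proj₁ (ψ P) ≡ proj₁ (ψ Q))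
  (ψ-involutive : ∀ P → proj₁ (ψ (ψ P)) ≡ proj₁ P)
  (ψ-antitone : ∀ {P Q} → _≤S_ {n} P Q → _≤S_ {n} (ψ Q) (ψ P))
  where

  ≤S⇔ : ∀ P Q → _≤S_ {n} P Q ⇔ _≤S_ {n} (ψ Q) (ψ P)
  ≤S⇔ P Q = mk⇔ ψ-antitone
    (λ ψQ≤ψP → ≤S-resp {n} {ψ (ψ P)} {P} {ψ (ψ Q)} {Q}
                 (ψ-involutive P) (ψ-involutive Q) (ψ-antitone ψQ≤ψP))

  ψ-antitone-< : ∀ {P Q} → _<S_ {n} P Q → _<S_ {n} (ψ Q) (ψ P)
  ψ-antitone-< {P} {Q} (P≤Q , P≢Q) = ψ-antitone P≤Q , λ ψQ≡ψP →
    P≢Q (trans (sym (ψ-involutive P)) (trans (ψ-cong (sym ψQ≡ψP)) (ψ-involutive Q)))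

  ψ-reflects-< : ∀ {P Q} → _<S_ {n} (ψ Q) (ψ P) → _<S_ {n} P Q
  ψ-reflects-< {P} {Q} ψQ<ψP =
    <S-resp {n} {ψ (ψ P)} {P} {ψ (ψ Q)} {Q} (ψ-involutive P) (ψ-involutive Q) (ψ-antitone-< ψQ<ψP)

  covers⇔ : ∀ P Q → Covers {n} Q P ⇔ Covers {n} (ψ P) (ψ Q)
  covers⇔ P Q = mk⇔ to from
    where
    to : Covers {n} Q P → Covers {n} (ψ P) (ψ Q)
    to (P<Q , nothing-between) = ψ-antitone-< P<Q , λ (R , ψQ<R , R<ψP) → nothing-between
      (ψ R , <S-resp {n} {ψ (ψ P)} {P} {ψ R} {ψ R} (ψ-involutive P) refl (ψ-antitone-< R<ψP)
           , <S-resp {n} {ψ R} {ψ R} {ψ (ψ Q)} {Q} refl (ψ-involutive Q) (ψ-antitone-< ψQ<R))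
    from : Covers {n} (ψ P) (ψ Q) → Covers {n} Q P
    from (ψQ<ψP , nothing-between) = ψ-reflects-< ψQ<ψP , λ (R , P<R , R<Q) → nothing-between
      (ψ R , ψ-antitone-< R<Q , ψ-antitone-< P<R)

module _ {n} (1≤n : 1 ≤ n) where

  word≡enc-A : (P : F∞ n) → proj₁ P ≡ enc (A {n} P)
  word≡enc-A (_ , isDyck , avoids) = decode 1≤n isDyck avoids

  suc-length-A : (P : F∞ n) → suc (length (A {n} P)) ≡ n
  suc-length-A P@(w , (length≡2n , _) , _) = *-cancelˡ-≡ _ _ 2 (begin
    2 * suc (length (A {n} P)) ≡⟨ length-enc (A {n} P) ⟨
    length (enc (A {n} P))     ≡⟨ cong length (word≡enc-A P) ⟨
    length w                   ≡⟨ length≡2n ⟩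
    2 * n                      ∎)
    where open ≡-Reasoning

  same-length-A : (P Q : F∞ n) → length (A {n} P) ≡ length (A {n} Q)
  same-length-A P Q = suc-injective (trans (suc-length-A P) (sym (suc-length-A Q)))

  A-injective : ∀ {P Q : F∞ n} → A {n} P ≡ A {n} Q → proj₁ P ≡ proj₁ Q
  A-injective {P} {Q} AP≡AQ = trans (word≡enc-A P) (trans (cong enc AP≡AQ) (sym (word≡enc-A Q)))

  ≤S⇔⊑ : (P Q : F∞ n) → _≤S_ {n} P Q ⇔ A {n} P ⊑ A {n} Q
  ≤S⇔⊑ P Q = subst₂ (λ v w → (∀ k → heightAt v k ℤ.≤ heightAt w k) ⇔ A {n} P ⊑ A {n} Q)
    (sym (word≡enc-A P)) (sym (word≡enc-A Q)) (enc-≤⇔⊑ (same-length-A P Q))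

  complementation : F∞ n → F∞ n
  complementation P =
    encode (complement (A {n} P)) (trans (cong suc (length-map not (A {n} P))) (suc-length-A P))

  A-complementation : ∀ P → A {n} (complementation P) ≡ complement (A {n} P)
  A-complementation P = A-enc (complement (A {n} P))

  module _ (ψ : F∞ n → F∞ n) (A-ψ : ∀ P → A {n} (ψ P) ≡ complement (A {n} P)) where

    ψ-cong : ∀ {P Q} → proj₁ P ≡ proj₁ Q → proj₁ (ψ P) ≡ proj₁ (ψ Q)
    ψ-cong {P} {Q} P≡Q = A-injective {ψ P} {ψ Q} (trans (A-ψ P)
      (trans (cong (λ w → complement (scanA false (dropInit w))) P≡Q) (sym (A-ψ Q))))

    ψ-involutive : ∀ P → proj₁ (ψ (ψ P)) ≡ proj₁ P
    ψ-involutive P = A-injective {ψ (ψ P)} {P}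
      (trans (A-ψ (ψ P)) (trans (cong complement (A-ψ P)) (complement-involutive (A {n} P))))

    ψ-antitone : ∀ {P Q} → _≤S_ {n} P Q → _≤S_ {n} (ψ Q) (ψ P)
    ψ-antitone {P} {Q} P≤Q = Equivalence.from (≤S⇔⊑ (ψ Q) (ψ P))
      (subst₂ _⊑_ (sym (A-ψ Q)) (sym (A-ψ P))
        (complement-antitone (same-length-A P Q) (Equivalence.to (≤S⇔⊑ P Q) P≤Q)))

theorem5p4 : (n : ℕ) → 1 ≤ n →
    -- ψ(P) = A⁻¹([1,n-1] ∖ A(P)) exists (as a function) ...
    Σ (F∞ n → F∞ n) (λ ψ → ∀ P → A {n} (ψ P) ≡ complement (A {n} P))
    -- ... and any such ψ satisfies:
    × ((ψ : F∞ n → F∞ n) → (∀ P → A {n} (ψ P) ≡ complement (A {n} P)) →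
         ((P Q : F∞ n) → Covers {n} Q P ⇔ Covers {n} (ψ P) (ψ Q))
       × ((P : F∞ n) → proj₁ (ψ (ψ P)) ≡ proj₁ P)
       × ((P Q : F∞ n) → _≤S_ {n} P Q ⇔ _≤S_ {n} (ψ Q) (ψ P)))
theorem5p4 n 1≤n = (complementation 1≤n , A-complementation 1≤n) , λ ψ A-ψ →
  let open AntitoneInvolution {n} ψ (ψ-cong 1≤n ψ A-ψ) (ψ-involutive 1≤n ψ A-ψ) (ψ-antitone 1≤n ψ A-ψ)
  in covers⇔ , ψ-involutive 1≤n ψ A-ψ , ≤S⇔
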